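{- Let $q\ge2$ and $n_0\ge0$ be integers, let $x\colon\mathbb{N}_0\to\mathbb{C}$, and let $v\colon\mathbb{N}_0\to\mathbb{C}^D$ be a sequence whose first component is $x$, together with matrices $A_0,\dots,A_{q-1}\in\mathbb{C}^{D\times D}$ such that $v(qn+r)=A_rv(n)$ for all $0\le r<q$ and all $n\ge n_0$. For $0\le k<n_0$ let $\delta_k\colon\mathbb{N}_0\to\mathbb{C}$, $\delta_k(n)=[n=k]$. For $0\le r<q$ and $0\le k<n_0$ let $w_{r,k}\coloneqq v(qk+r)-A_rv(k)\in\mathbb{C}^D$, let $W_r$ be the $D\times n_0$ matrix with columns $w_{r,0},\dots,w_{r,n_0-1}$, and let $J_r\in\{0,1\}^{n_0\times n_0}$ be the matrix whose entry in row $k$ and column $j$ ($0\le k,j<n_0$) is $[jq=k-r]$. Define \[\widetilde v=\begin{pmatrix}v\\ \delta_0\\ \vdots\\ \delta_{n_0-1}\end{pmatrix},\qquad \widetilde A_r=\begin{pmatrix}A_r&W_r\\0&J_r\end{pmatrix}\quad(0\le r<q).\] Then $\widetilde v(qn+r)=\widetilde A_r\widetilde v(n)$ holds for all $0\le r<q$ and all $n\ge0$; hence $(\widetilde A_0,\dots,\widetilde A_{q-1},\widetilde v)$ is a $q$-linear representation of $x$ and $x$ is $q$-regular. Moreover, each $J_r$ is lower triangular with diagonal $([r=0],0,\dots,0)$.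
   Context: $[S]$ denotes the Iverson bracket. A $q$-linear representation of $x$ is a tuple $(B_0,\dots,B_{q-1},w)$ with $w\colon\mathbb{N}_0\to\mathbb{C}^{E}$ having first component $x$ and $w(qn+r)=B_rw(n)$ for all $0\le r<q$, $n\ge0$; $x$ is $q$-regular if it has such a representation (equivalently, the $\mathbb{C}$-span of $\{n\mapsto x(q^jn+r): j\ge0,\ 0\le r<q^j\}$ is finite-dimensional). -}

module Defs where

open import Level using (Level)
open import Algebra.Bundles using (CommutativeRing)
open import Data.Nat as ℕ using (ℕ; zero; suc; _≟_)
open import Data.Fin as Fin using (Fin; zero; suc; toℕ; splitAt)
open import Data.Sum using (inj₁; inj₂)
open import Data.Product using (Σ; _×_)
open import Relation.Nullary using (Dec; yes; no)

module LinRep {c ℓ : Level} (R : CommutativeRing c ℓ) where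
  open CommutativeRing R public using (Carrier; _≈_; 0#; 1#)
  open CommutativeRing R using (_+_; _*_; _-_)

  Vec : ℕ → Set c
  Vec n = Fin n → Carrier

  Mat : ℕ → ℕ → Set c
  Mat m n = Fin m → Fin n → Carrier

  Σᶠ : ∀ {n} → (Fin n → Carrier) → Carrier
  Σᶠ {zero}  f = 0#
  Σᶠ {suc n} f = f zero + Σᶠ (λ i → f (suc i))

  _·_ : ∀ {m n} → Mat m n → Vec n → Vec m
  (M · u) i = Σᶠ (λ j → M i j * u j)

  _≈ᵥ_ : ∀ {n} → Vec n → Vec n → Set ℓ
  u ≈ᵥ w = ∀ i → u i ≈ w i

  ⟦_⟧ : ∀ {p} {P : Set p} → Dec P → Carrier
  ⟦ yes _ ⟧ = 1#
  ⟦ no  _ ⟧ = 0#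

  IsLinearRep : (q : ℕ) (x : ℕ → Carrier) {E : ℕ}
                (B : Fin q → Mat (suc E) (suc E)) (w : ℕ → Vec (suc E)) → Set ℓ
  IsLinearRep q x B w =
    (∀ n → w n zero ≈ x n) ×
    (∀ (r : Fin q) (n : ℕ) → w (q ℕ.* n ℕ.+ toℕ r) ≈ᵥ (B r · w n))

  IsRegular : (q : ℕ) (x : ℕ → Carrier) → Set (c Level.⊔ ℓ)
  IsRegular q x =
    Σ ℕ λ E → Σ (Fin q → Mat (suc E) (suc E)) λ B → Σ (ℕ → Vec (suc E)) λ w →
      IsLinearRep q x B w

  -- the construction of Theorem 3.10; D = suc d
  module Construction (q n₀ d : ℕ) (v : ℕ → Vec (suc d))
                      (A : Fin q → Mat (suc d) (suc d)) where

    δ : Fin n₀ → ℕ → Carrier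
    δ k n = ⟦ n ≟ toℕ k ⟧

    wᵣₖ : Fin q → Fin n₀ → Vec (suc d)
    wᵣₖ r k i = v (q ℕ.* toℕ k ℕ.+ toℕ r) i - (A r · v (toℕ k)) i

    W : Fin q → Mat (suc d) n₀
    W r i k = wᵣₖ r k i

    -- J_r (k , j) = [j q = k - r]   (as integers, i.e. j q + r = k)
    J : Fin q → Mat n₀ n₀
    J r k j = ⟦ toℕ j ℕ.* q ℕ.+ toℕ r ≟ toℕ k ⟧

    ṽ : ℕ → Vec (suc d ℕ.+ n₀)
    ṽ n i with splitAt (suc d) i
    ... | inj₁ a = v n a
    ... | inj₂ k = δ k n

    Ã : Fin q → Mat (suc d ℕ.+ n₀) (suc d ℕ.+ n₀)
    Ã r i j with splitAt (suc d) i | splitAt (suc d) j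
    ... | inj₁ a | inj₁ b = A r a b
    ... | inj₁ a | inj₂ l = W r a l
    ... | inj₂ k | inj₁ b = 0#
    ... | inj₂ k | inj₂ l = J r k l

-- For n ≥ n₀ the δ-block of ṽ(n) vanishes, so the top block row of Ã_r is the given
-- recursion and the bottom one reads δ_k(qn + r) = 0 (as k < n₀ ≤ qn + r).
-- For n < n₀ the δ-block of ṽ(n) is the unit vector e_n: the top block row then adds
-- the column w_{r,n} = v(qn + r) − A_r v(n), which repairs the recursion exactly, and
-- the bottom one gives (J_r e_n)_k = [nq + r = k] = δ_k(qn + r). J_r is triangular
-- because jq + r ≥ j, with equality only for j = r = 0 once q ≥ 2.
module Submission where

open import Defs
open import Level using (Level)
open import Algebra.Bundles using (CommutativeRing)
open import Data.Nat as ℕ using (ℕ; zero; suc; _≤_; _<_; _≟_; NonZero)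
open import Data.Nat.Properties
  using (_≤?_; ≰⇒>; ≤-trans; <-≤-trans; m≤m+n; m≤m*n; m≤n*m; m<m*n; *-comm; >⇒≢)
open import Data.Fin using (Fin; zero; suc; toℕ; splitAt; fromℕ<; _↑ˡ_; _↑ʳ_)
open import Data.Fin.Properties
  using (toℕ<n; toℕ-injective; toℕ-fromℕ<; splitAt-↑ˡ; splitAt-↑ʳ; splitAt⁻¹-↑ˡ; splitAt⁻¹-↑ʳ)
open import Data.Product using (_×_; _,_; ∃)
open import Data.Sum using (_⊎_; inj₁; inj₂)
open import Data.Empty using (⊥-elim)
open import Function.Bundles using (_⇔_; mk⇔; Equivalence)
open import Relation.Nullary using (Dec; yes; no; ¬_; _×-dec_)
open import Relation.Binary.PropositionalEquality as ≡ using (_≡_; _≢_; refl; cong; cong₂; subst)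
import Algebra.Properties.Group as GroupProperties
import Relation.Binary.Reasoning.Setoid as SetoidReasoning

↑-elim : ∀ {p} m {n} {P : Fin (m ℕ.+ n) → Set p} →
         (∀ a → P (a ↑ˡ n)) → (∀ k → P (m ↑ʳ k)) → ∀ i → P i
↑-elim m {P = P} left right i with splitAt m i in eq
... | inj₁ a = subst P (splitAt⁻¹-↑ˡ eq) (left a)
... | inj₂ k = subst P (splitAt⁻¹-↑ʳ eq) (right k)

≤-or-index : ∀ n₀ n → n₀ ≤ n ⊎ ∃ λ (k : Fin n₀) → toℕ k ≡ n
≤-or-index n₀ n with n₀ ≤? n
... | yes n₀≤n = inj₁ n₀≤n
... | no n₀≰n  = inj₂ (fromℕ< (≰⇒> n₀≰n) , toℕ-fromℕ< (≰⇒> n₀≰n))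

m*n+o≡m⇔m≡0×o≡0 : ∀ {m n o} → 1 < n → (m ℕ.* n ℕ.+ o ≡ m) ⇔ (m ≡ 0 × o ≡ 0)
m*n+o≡m⇔m≡0×o≡0 {m} {n} {o} 1<n = mk⇔ (to m) λ { (refl , refl) → refl }
  where
  to : ∀ m → m ℕ.* n ℕ.+ o ≡ m → m ≡ 0 × o ≡ 0
  to zero    o≡0 = refl , o≡0
  to (suc m) eq  = ⊥-elim (>⇒≢ (<-≤-trans (m<m*n (suc m) n 1<n) (m≤m+n _ o)) eq)

module _ {c ℓ : Level} (R : CommutativeRing c ℓ) where
  open LinRep R
  open CommutativeRing R
    using (_+_; _*_; setoid; sym; trans; reflexive; +-cong; *-cong; +-comm; +-assoc;
           +-identityˡ; +-identityʳ; zeroˡ; zeroʳ; *-identityʳ; +-group)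
    renaming (refl to ≈-refl)
  open GroupProperties +-group using (//-rightDividesˡ)
  open SetoidReasoning setoid

  ⟦⟧-yes : ∀ {p} {P : Set p} (P? : Dec P) → P → ⟦ P? ⟧ ≡ 1#
  ⟦⟧-yes (yes _) _  = refl
  ⟦⟧-yes (no ¬p) p = ⊥-elim (¬p p)

  ⟦⟧-no : ∀ {p} {P : Set p} (P? : Dec P) → ¬ P → ⟦ P? ⟧ ≡ 0#
  ⟦⟧-no (yes p) ¬p = ⊥-elim (¬p p)
  ⟦⟧-no (no _)  _  = refl

  ⟦⟧-cong : ∀ {p q} {P : Set p} {Q : Set q} (P? : Dec P) (Q? : Dec Q) →
            P ⇔ Q → ⟦ P? ⟧ ≡ ⟦ Q? ⟧
  ⟦⟧-cong (yes p) Q? P⇔Q = ≡.sym (⟦⟧-yes Q? (Equivalence.to P⇔Q p))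
  ⟦⟧-cong (no ¬p) Q? P⇔Q = ≡.sym (⟦⟧-no Q? (λ q → ¬p (Equivalence.from P⇔Q q)))

  Σᶠ-cong : ∀ {n} {f g : Fin n → Carrier} → (∀ i → f i ≈ g i) → Σᶠ f ≈ Σᶠ g
  Σᶠ-cong {zero}  f≈g = ≈-refl
  Σᶠ-cong {suc n} f≈g = +-cong (f≈g zero) (Σᶠ-cong (λ i → f≈g (suc i)))

  Σᶠ-zero : ∀ {n} {f : Fin n → Carrier} → (∀ i → f i ≈ 0#) → Σᶠ f ≈ 0#
  Σᶠ-zero {zero}  f≈0 = ≈-refl
  Σᶠ-zero {suc n} f≈0 = trans (+-cong (f≈0 zero) (Σᶠ-zero (λ i → f≈0 (suc i)))) (+-identityʳ 0#)

  Σᶠ-single : ∀ {n} {f : Fin n → Carrier} (j : Fin n) → (∀ i → i ≢ j → f i ≈ 0#) → Σᶠ f ≈ f j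
  Σᶠ-single zero f≈0 =
    trans (+-cong ≈-refl (Σᶠ-zero (λ i → f≈0 (suc i) (λ ())))) (+-identityʳ _)
  Σᶠ-single (suc j) f≈0 =
    trans (+-cong (f≈0 zero (λ ())) (Σᶠ-single j (λ i i≢j → f≈0 (suc i) (λ { refl → i≢j refl }))))
          (+-identityˡ _)

  Σᶠ-++ : ∀ m {n} (f : Fin (m ℕ.+ n) → Carrier) →
          Σᶠ f ≈ Σᶠ (λ a → f (a ↑ˡ n)) + Σᶠ (λ k → f (m ↑ʳ k))
  Σᶠ-++ zero    f = sym (+-identityˡ _)
  Σᶠ-++ (suc m) f = trans (+-cong ≈-refl (Σᶠ-++ m (λ i → f (suc i)))) (sym (+-assoc _ _ _))

  Σᶠ-δ-index : ∀ {n} (g : Fin n → Carrier) (k : Fin n) →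
               Σᶠ (λ l → g l * ⟦ toℕ k ≟ toℕ l ⟧) ≈ g k
  Σᶠ-δ-index g k = begin
    Σᶠ (λ l → g l * ⟦ toℕ k ≟ toℕ l ⟧) ≈⟨ Σᶠ-single k off-diagonal ⟩
    g k * ⟦ toℕ k ≟ toℕ k ⟧            ≈⟨ *-cong ≈-refl (reflexive (⟦⟧-yes (toℕ k ≟ toℕ k) refl)) ⟩
    g k * 1#                           ≈⟨ *-identityʳ (g k) ⟩
    g k                                ∎
    where
    off-diagonal : ∀ l → l ≢ k → g l * ⟦ toℕ k ≟ toℕ l ⟧ ≈ 0#
    off-diagonal l l≢k =
      trans (*-cong ≈-refl (reflexive (⟦⟧-no (toℕ k ≟ toℕ l) (λ k≡l → l≢k (toℕ-injective (≡.sym k≡l)))))) (zeroʳ _)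

  Σᶠ-δ-≥ : ∀ {n} (g : Fin n → Carrier) m → n ≤ m → Σᶠ (λ l → g l * ⟦ m ≟ toℕ l ⟧) ≈ 0#
  Σᶠ-δ-≥ g m n≤m = Σᶠ-zero λ l →
    trans (*-cong ≈-refl (reflexive (⟦⟧-no (m ≟ toℕ l) (>⇒≢ (<-≤-trans (toℕ<n l) n≤m))))) (zeroʳ _)

  module ConstructionProperties (q n₀ d : ℕ) {{_ : NonZero q}}
                                (v : ℕ → Vec (suc d)) (A : Fin q → Mat (suc d) (suc d)) where
    open Construction q n₀ d v A

    RecursiveFrom-n₀ : Set ℓ
    RecursiveFrom-n₀ = ∀ r n → n₀ ≤ n → v (q ℕ.* n ℕ.+ toℕ r) ≈ᵥ (A r · v n)

    ṽ-↑ˡ : ∀ n a → ṽ n (a ↑ˡ n₀) ≡ v n a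
    ṽ-↑ˡ n a rewrite splitAt-↑ˡ (suc d) a n₀ = refl

    ṽ-↑ʳ : ∀ n k → ṽ n (suc d ↑ʳ k) ≡ δ k n
    ṽ-↑ʳ n k rewrite splitAt-↑ʳ (suc d) n₀ k = refl

    Ã-↑ˡ-↑ˡ : ∀ r a b → Ã r (a ↑ˡ n₀) (b ↑ˡ n₀) ≡ A r a b
    Ã-↑ˡ-↑ˡ r a b rewrite splitAt-↑ˡ (suc d) a n₀ | splitAt-↑ˡ (suc d) b n₀ = refl

    Ã-↑ˡ-↑ʳ : ∀ r a l → Ã r (a ↑ˡ n₀) (suc d ↑ʳ l) ≡ W r a l
    Ã-↑ˡ-↑ʳ r a l rewrite splitAt-↑ˡ (suc d) a n₀ | splitAt-↑ʳ (suc d) n₀ l = refl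

    Ã-↑ʳ-↑ˡ : ∀ r k b → Ã r (suc d ↑ʳ k) (b ↑ˡ n₀) ≡ 0#
    Ã-↑ʳ-↑ˡ r k b rewrite splitAt-↑ʳ (suc d) n₀ k | splitAt-↑ˡ (suc d) b n₀ = refl

    Ã-↑ʳ-↑ʳ : ∀ r k l → Ã r (suc d ↑ʳ k) (suc d ↑ʳ l) ≡ J r k l
    Ã-↑ʳ-↑ʳ r k l rewrite splitAt-↑ʳ (suc d) n₀ k | splitAt-↑ʳ (suc d) n₀ l = refl

    Ã·ṽ-↑ˡ : ∀ r n a → (Ã r · ṽ n) (a ↑ˡ n₀) ≈ (A r · v n) a + Σᶠ (λ l → W r a l * δ l n)
    Ã·ṽ-↑ˡ r n a = trans (Σᶠ-++ (suc d) (λ j → Ã r (a ↑ˡ n₀) j * ṽ n j)) (+-cong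
      (Σᶠ-cong λ b → reflexive (cong₂ _*_ (Ã-↑ˡ-↑ˡ r a b) (ṽ-↑ˡ n b)))
      (Σᶠ-cong λ l → reflexive (cong₂ _*_ (Ã-↑ˡ-↑ʳ r a l) (ṽ-↑ʳ n l))))

    Ã·ṽ-↑ʳ : ∀ r n k → (Ã r · ṽ n) (suc d ↑ʳ k) ≈ Σᶠ (λ l → J r k l * δ l n)
    Ã·ṽ-↑ʳ r n k = trans (Σᶠ-++ (suc d) (λ j → Ã r (suc d ↑ʳ k) j * ṽ n j)) (trans (+-cong
      (Σᶠ-zero λ b → trans (reflexive (cong (_* ṽ n (b ↑ˡ n₀)) (Ã-↑ʳ-↑ˡ r k b))) (zeroˡ _))
      (Σᶠ-cong λ l → reflexive (cong₂ _*_ (Ã-↑ʳ-↑ʳ r k l) (ṽ-↑ʳ n l))))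
      (+-identityˡ _))

    v-step : RecursiveFrom-n₀ →
             ∀ r n a → v (q ℕ.* n ℕ.+ toℕ r) a ≈ (A r · v n) a + Σᶠ (λ l → W r a l * δ l n)
    v-step v-rec r n a with ≤-or-index n₀ n
    ... | inj₁ n₀≤n = begin
      v (q ℕ.* n ℕ.+ toℕ r) a                    ≈⟨ v-rec r n n₀≤n a ⟩
      (A r · v n) a                              ≈⟨ +-identityʳ _ ⟨
      (A r · v n) a + 0#                         ≈⟨ +-cong ≈-refl (Σᶠ-δ-≥ (W r a) n n₀≤n) ⟨
      (A r · v n) a + Σᶠ (λ l → W r a l * δ l n) ∎
    ... | inj₂ (k , refl) = begin
      v (q ℕ.* toℕ k ℕ.+ toℕ r) a                  ≈⟨ //-rightDividesˡ (A·v a) _ ⟨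
      W r a k + A·v a                              ≈⟨ +-comm _ _ ⟩
      A·v a + W r a k                              ≈⟨ +-cong ≈-refl (Σᶠ-δ-index (W r a) k) ⟨
      A·v a + Σᶠ (λ l → W r a l * δ l (toℕ k))     ∎
      where
      A·v : Vec (suc d)
      A·v = A r · v (toℕ k)

    δ-step : ∀ r n k → δ k (q ℕ.* n ℕ.+ toℕ r) ≈ Σᶠ (λ l → J r k l * δ l n)
    δ-step r n k with ≤-or-index n₀ n
    ... | inj₁ n₀≤n = begin
      δ k (q ℕ.* n ℕ.+ toℕ r)     ≈⟨ reflexive (⟦⟧-no (_ ≟ toℕ k) (>⇒≢ k<qn+r)) ⟩
      0#                         ≈⟨ Σᶠ-δ-≥ (J r k) n n₀≤n ⟨
      Σᶠ (λ l → J r k l * δ l n) ∎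
      where
      k<qn+r : toℕ k < q ℕ.* n ℕ.+ toℕ r
      k<qn+r = <-≤-trans (toℕ<n k) (≤-trans n₀≤n (≤-trans (m≤n*m n q) (m≤m+n _ _)))
    ... | inj₂ (j , refl) = begin
      δ k (q ℕ.* toℕ j ℕ.+ toℕ r)          ≡⟨ cong (λ m → ⟦ m ℕ.+ toℕ r ≟ toℕ k ⟧) (*-comm q (toℕ j)) ⟩
      J r k j                              ≈⟨ Σᶠ-δ-index (J r k) j ⟨
      Σᶠ (λ l → J r k l * δ l (toℕ j))     ∎

    ṽ-step : RecursiveFrom-n₀ →
             ∀ r n → ṽ (q ℕ.* n ℕ.+ toℕ r) ≈ᵥ (Ã r · ṽ n)
    ṽ-step v-rec r n = ↑-elim (suc d) {P = λ i → ṽ (q ℕ.* n ℕ.+ toℕ r) i ≈ (Ã r · ṽ n) i}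
      (λ a → trans (reflexive (ṽ-↑ˡ _ a)) (trans (v-step v-rec r n a) (sym (Ã·ṽ-↑ˡ r n a))))
      (λ k → trans (reflexive (ṽ-↑ʳ _ k)) (trans (δ-step r n k) (sym (Ã·ṽ-↑ʳ r n k))))

    J-upper : ∀ r k j → toℕ k < toℕ j → J r k j ≈ 0#
    J-upper r k j k<j =
      reflexive (⟦⟧-no (_ ≟ toℕ k) (>⇒≢ (<-≤-trans k<j (≤-trans (m≤m*n (toℕ j) q) (m≤m+n _ _)))))

    J-diagonal : 1 < q → ∀ r k → J r k k ≈ ⟦ (toℕ k ≟ 0) ×-dec (toℕ r ≟ 0) ⟧
    J-diagonal 1<q r k = reflexive
      (⟦⟧-cong (toℕ k ℕ.* q ℕ.+ toℕ r ≟ toℕ k) ((toℕ k ≟ 0) ×-dec (toℕ r ≟ 0)) (m*n+o≡m⇔m≡0×o≡0 1<q))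

open import Data.Nat using (_+_; _*_)

theorem3p10 : ∀ {c ℓ : Level} (R : CommutativeRing c ℓ) →
    let open LinRep R in (q n₀ d : ℕ) → 2 ≤ q →
       (x : ℕ → Carrier) (v : ℕ → Vec (suc d)) (A : Fin q → Mat (suc d) (suc d)) →
       (∀ n → v n zero ≈ x n) →
       (∀ (r : Fin q) (n : ℕ) → n₀ ≤ n → v (q * n + toℕ r) ≈ᵥ (A r · v n)) →
       let open Construction q n₀ d v A
       in (∀ (r : Fin q) (n : ℕ) → ṽ (q * n + toℕ r) ≈ᵥ (Ã r · ṽ n))
          × IsLinearRep q x Ã ṽ
          × IsRegular q x
          × (∀ (r : Fin q) (k j : Fin n₀) → toℕ k < toℕ j → J r k j ≈ 0#)
          × (∀ (r : Fin q) (k : Fin n₀) →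
               J r k k ≈ ⟦ (toℕ k ≟ 0) ×-dec (toℕ r ≟ 0) ⟧)
theorem3p10 R q n₀ d 2≤q x v A v₀≈x v-rec =
  ṽ-step v-rec , linearRep , (d + n₀ , Ã , ṽ , linearRep) , J-upper , J-diagonal 2≤q
  where
  instance
    q≢0 : NonZero q
    q≢0 = ℕ.>-nonZero (≤-trans (ℕ.s≤s ℕ.z≤n) 2≤q)
  open ConstructionProperties R q n₀ d v A
  open LinRep R using (IsLinearRep)
  open LinRep.Construction R q n₀ d v A using (Ã; ṽ)

  linearRep : IsLinearRep q x Ã ṽ
  linearRep = v₀≈x , ṽ-step v-rec
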